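{- Let $\varphi$ be a formula of the logic $\mathcal{L}$, written in the primitive connectives $\neg,\land,\square$ (all abbreviations expanded). An occurrence of a subformula is called positive (resp. negative) if it lies in the scope of an even (resp. odd) number of negation symbols $\neg$. (i) If every occurrence of an atomic subformula (goal atom) in $\varphi$ is positive, then $\varphi$ has positive persistence, i.e. $\varphi$ is a goal formula. (ii) If every occurrence of an atomic subformula in $\varphi$ is negative, then $\varphi$ has negative persistence.
   Context: Let $\mathcal{U}$ be a countable set of goal atoms. The language $\mathcal{L}$ over $\mathcal{U}$ is the smallest set containing every $a\in\mathcal{U}$ and closed under: if $\varphi,\psi\in\mathcal{L}$ then $(\neg\varphi),(\varphi\land\psi),(\square\varphi)\in\mathcal{L}$. Abbreviations: $\varphi\lor\psi:=\neg(\neg\varphi\land\neg\psi)$, $\varphi\supset\psi:=\neg\varphi\lor\psi$, $\Diamond\varphi:=\neg\square\neg\varphi$, $\varphi<\psi:=\psi\supset\Diamond\varphi$. An ordered model is a finite sequence of atoms from $\mathcal{U}$ without repetition. For sequences $P,Q$, $P$ is a prefix of $Q$, written $P\preceq Q$, iff $Q=PR$ for some (possibly empty) sequence $R$; this relation is reflexive and includes the empty sequence. Truth in an ordered model $M$: $M\models a$ iff $a$ occurs in $M$ (for $a\in\mathcal{U}$); $M\models\neg\psi$ iff $M\not\models\psi$; $M\models\psi\land\varphi$ iff $M\models\psi$ and $M\models\varphi$; $M\models\square\varphi$ iff $M'\models\varphi$ for every prefix $M'$ of $M$. A formula $\varphi$ has positive persistence iff $M\models\varphi$ implies $M'\models\varphi$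 for all ordered models $M\preceq M'$; it has negative persistence iff $M\not\models\varphi$ implies $M'\not\models\varphi$ for all ordered models $M\preceq M'$. A formula with positive persistence is called a goal formula. -}

module Defs where

open import Data.Bool using (Bool; true; false; not)
open import Data.List using (List; _++_)
open import Data.List.Membership.Propositional using (_∈_)
open import Data.List.Relation.Unary.Unique.Propositional using (Unique)
open import Data.Product using (_×_; Σ; ∃)
open import Relation.Binary.PropositionalEquality using (_≡_)
open import Relation.Nullary using (¬_)
open import Level using (Level; _⊔_)

data Form {u} (U : Set u) : Set u where
  atom : U → Form U
  ¬'   : Form U → Form U
  _∧'_ : Form U → Form U → Form U
  □'   : Form U → Form U

record OModel {u} (U : Set u) : Set u where
  constructor omodel
  field
    seq    : List U
    unique : Unique seq
open OModel public

_⪯_ : ∀ {u} {U : Set u} → List U → List U → Set u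
P ⪯ Q = ∃ λ R → Q ≡ P ++ R

-- Truth in a sequence (used on ordered models; prefixes of an ordered model
-- are again ordered models, so quantifying over prefix sequences is the same)
_⊨_ : ∀ {u} {U : Set u} → List U → Form U → Set u
M ⊨ atom a   = a ∈ M
M ⊨ ¬' φ     = ¬ (M ⊨ φ)
M ⊨ (φ ∧' ψ) = (M ⊨ φ) × (M ⊨ ψ)
M ⊨ □' φ     = ∀ M' → M' ⪯ M → M' ⊨ φ

_⊨ₘ_ : ∀ {u} {U : Set u} → OModel U → Form U → Set u
M ⊨ₘ φ = seq M ⊨ φ

PositivePersistence : ∀ {u} {U : Set u} → Form U → Set u
PositivePersistence φ = ∀ (M M' : OModel _) → seq M ⪯ seq M' → M ⊨ₘ φ → M' ⊨ₘ φ

NegativePersistence : ∀ {u} {U : Set u} → Form U → Set u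
NegativePersistence φ = ∀ (M M' : OModel _) → seq M ⪯ seq M' → ¬ (M ⊨ₘ φ) → ¬ (M' ⊨ₘ φ)

-- AtomsAt target cur φ : every atom occurrence in φ, where the current
-- negation-count parity at the root of φ is cur (true = odd), has parity target.
AtomsAt : ∀ {u} {U : Set u} → Bool → Bool → Form U → Set
AtomsAt t c (atom _) = c ≡ t
AtomsAt t c (¬' φ)   = AtomsAt t (not c) φ
AtomsAt t c (φ ∧' ψ) = AtomsAt t c φ × AtomsAt t c ψ
AtomsAt t c (□' φ)   = AtomsAt t c φ

AllAtomsPositive : ∀ {u} {U : Set u} → Form U → Set
AllAtomsPositive φ = AtomsAt false false φ

AllAtomsNegative : ∀ {u} {U : Set u} → Form U → Set
AllAtomsNegative φ = AtomsAt true false φ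

-- A formula is upward closed (true on M implies true on every extension) or
-- downward closed (true on M implies true on every prefix). Negation swaps the
-- two, conjunction preserves both, and □φ is downward closed for every φ.
-- □ also preserves upward closure: the prefixes of an extension of M are either
-- prefixes of M or extensions of M, since prefixes of one sequence are
-- comparable. Atoms are upward closed but not downward closed, so atoms may
-- only occur at positive (resp. negative) polarity, and induction on φ with
-- the polarity tracked gives both claims.
module Submission where

open import Defs
open import Data.Nat using (ℕ)
open import Data.Bool using (Bool; false; not)
open import Data.Bool.Properties using (not-involutive; not-¬)
open import Data.Empty using (⊥-elim)
open import Data.List using (List; []; _∷_; _++_)
open import Data.List.Properties using (++-assoc; ++-identityʳ; ∷-injective)
open import Data.List.Membership.Propositional.Properties using (∈-++⁺ˡ)
open import Data.Product using (_×_; _,_)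
open import Data.Sum using (_⊎_; inj₁; inj₂)
open import Function.Bundles using (_↣_)
open import Relation.Binary.PropositionalEquality using (_≡_; refl; sym; trans; cong; subst)

module _ {u} {U : Set u} where

  ⪯-refl : {A : List U} → A ⪯ A
  ⪯-refl {A} = [] , sym (++-identityʳ A)

  ⪯-trans : {A B C : List U} → A ⪯ B → B ⪯ C → A ⪯ C
  ⪯-trans {A} (R , refl) (S , refl) = R ++ S , ++-assoc A R S

  ++-prefixes-comparable : (A R B S : List U) → A ++ R ≡ B ++ S → A ⪯ B ⊎ B ⪯ A
  ++-prefixes-comparable []      R B       S e = inj₁ (B , refl)
  ++-prefixes-comparable (x ∷ A) R []      S e = inj₂ (x ∷ A , refl)
  ++-prefixes-comparable (x ∷ A) R (y ∷ B) S e with ∷-injective e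
  ... | refl , e′ with ++-prefixes-comparable A R B S e′
  ... | inj₁ (T , p) = inj₁ (T , cong (x ∷_) p)
  ... | inj₂ (T , p) = inj₂ (T , cong (x ∷_) p)

  ⪯-comparable : {A B C : List U} → A ⪯ C → B ⪯ C → A ⪯ B ⊎ B ⪯ A
  ⪯-comparable {A} {B} (R , p) (S , q) = ++-prefixes-comparable A R B S (trans (sym p) q)

  Upward : Form U → Set u
  Upward φ = ∀ {M M′} → M ⪯ M′ → M ⊨ φ → M′ ⊨ φ

  Downward : Form U → Set u
  Downward φ = ∀ {M M′} → M ⪯ M′ → M′ ⊨ φ → M ⊨ φ

  atom-upward : (a : U) → Upward (atom a)
  atom-upward a (R , refl) = ∈-++⁺ˡ

  ¬-upward : {φ : Form U} → Downward φ → Upward (¬' φ)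
  ¬-upward down M⪯M′ ¬M⊨φ M′⊨φ = ¬M⊨φ (down M⪯M′ M′⊨φ)

  ¬-downward : {φ : Form U} → Upward φ → Downward (¬' φ)
  ¬-downward up M⪯M′ ¬M′⊨φ M⊨φ = ¬M′⊨φ (up M⪯M′ M⊨φ)

  ∧-upward : {φ ψ : Form U} → Upward φ → Upward ψ → Upward (φ ∧' ψ)
  ∧-upward upφ upψ M⪯M′ (M⊨φ , M⊨ψ) = upφ M⪯M′ M⊨φ , upψ M⪯M′ M⊨ψ

  ∧-downward : {φ ψ : Form U} → Downward φ → Downward ψ → Downward (φ ∧' ψ)
  ∧-downward downφ downψ M⪯M′ (M′⊨φ , M′⊨ψ) = downφ M⪯M′ M′⊨φ , downψ M⪯M′ M′⊨ψ

  □-upward : {φ : Form U} → Upward φ → Upward (□' φ)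
  □-upward up {M} M⪯M′ M⊨□φ N N⪯M′ with ⪯-comparable N⪯M′ M⪯M′
  ... | inj₁ N⪯M = M⊨□φ N N⪯M
  ... | inj₂ M⪯N = up M⪯N (M⊨□φ M ⪯-refl)

  □-downward : (φ : Form U) → Downward (□' φ)
  □-downward φ M⪯M′ M′⊨□φ N N⪯M = M′⊨□φ N (⪯-trans N⪯M M⪯M′)

  mutual
    upward : (c : Bool) (φ : Form U) → AtomsAt c c φ → Upward φ
    upward c (atom a) _        = atom-upward a
    upward c (¬' φ)   h        = ¬-upward (downward (not c) φ (subst (λ t → AtomsAt t (not c) φ) (sym (not-involutive c)) h))
    upward c (φ ∧' ψ) (hφ , hψ) = ∧-upward (upward c φ hφ) (upward c ψ hψ)
    upward c (□' φ)   h        = □-upward (upward c φ h)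

    downward : (c : Bool) (φ : Form U) → AtomsAt (not c) c φ → Downward φ
    downward c (atom a) c≡not-c   = ⊥-elim (not-¬ refl c≡not-c)
    downward c (¬' φ)   h         = ¬-downward (upward (not c) φ h)
    downward c (φ ∧' ψ) (hφ , hψ) = ∧-downward (downward c φ hφ) (downward c ψ hψ)
    downward c (□' φ)   _         = □-downward φ

theorem1 : ∀ {u} {U : Set u} → U ↣ ℕ → (φ : Form U)
    → (AllAtomsPositive φ → PositivePersistence φ)
    × (AllAtomsNegative φ → NegativePersistence φ)
theorem1 _ φ =
  (λ positive M M′ M⪯M′ → upward false φ positive M⪯M′) ,
  (λ negative M M′ M⪯M′ M⊭φ M′⊨φ → M⊭φ (downward false φ negative M⪯M′ M′⊨φ))
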